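{- Let $m\ge 2$. Let $\mathcal{P}$ be an integral point set in the plane $\mathbb{E}^2$ consisting of $n$ points, where $n-1$ of the points lie on a line $\ell$ and the remaining point has distance $h>0$ from $\ell$. Let $\mathcal{P}'$ be an integral point set in $\mathbb{E}^{m-1}$ consisting of $n'$ points, all of which lie on a sphere of radius $h$ in $\mathbb{E}^{m-1}$. Then $$d(m,n+n'-1)\le \max(\operatorname{diam}(\mathcal{P}),\operatorname{diam}(\mathcal{P}')).$$
   Context: An integral point set in the $k$-dimensional Euclidean space $\mathbb{E}^k$ is a set of points in $\mathbb{E}^k$ whose pairwise Euclidean distances are all integers and which are not all contained in a common affine hyperplane of $\mathbb{E}^k$. Its diameter $\operatorname{diam}$ is the largest distance between two of its points. For integers $n\ge m+1$, $d(m,n)$ denotes the minimum possible diameter of an integral point set in $\mathbb{E}^m$ consisting of $n$ points. A sphere of radius $h$ in $\mathbb{E}^{m-1}$ is the set of points at distance $h$ from a fixed center (for $m=2$ it consists of two points). -}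

module Defs where

open import Level using (0ℓ)
open import Data.Nat as ℕ using (ℕ; zero; suc; _⊔_)
open import Data.Fin using (Fin; zero; suc)
open import Data.Product using (Σ; ∃; _×_; _,_)
open import Relation.Nullary using (¬_)
open import Data.Sum using (_⊎_)
open import Relation.Binary.PropositionalEquality using (_≡_; _≢_)
open import Relation.Binary.Structures using (IsStrictTotalOrder)
open import Algebra.Structures using (IsCommutativeRing)

-- The real numbers, axiomatised as a (Dedekind-)complete ordered field.
-- All models are isomorphic, so quantifying over a model is the same as
-- working in ℝ.

record RealNumbers : Set₁ where
  infixl 6 _+_
  infixl 7 _*_
  infix 4 _<_
  field
    Carrier : Set
    _+_ _*_ : Carrier → Carrier → Carrier
    -_      : Carrier → Carrier
    0# 1#   : Carrier
    isCommutativeRing : IsCommutativeRing _≡_ _+_ _*_ -_ 0# 1#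
    0≢1     : 0# ≢ 1#
    inverse : ∀ x → x ≢ 0# → ∃ λ y → x * y ≡ 1#
    _<_     : Carrier → Carrier → Set
    isStrictTotalOrder : IsStrictTotalOrder _≡_ _<_
    +-mono-< : ∀ {x y} z → x < y → x + z < y + z
    *-pos    : ∀ {x y} → 0# < x → 0# < y → 0# < x * y
    complete : (S : Carrier → Set) → (∃ λ x → S x) →
               (∃ λ u → ∀ x → S x → (x < u) ⊎ (x ≡ u)) →
               ∃ λ s → (∀ x → S x → (x < s) ⊎ (x ≡ s)) ×
                       (∀ u → (∀ x → S x → (x < u) ⊎ (x ≡ u)) → (s < u) ⊎ (s ≡ u))

maxFin : ∀ {n} → (Fin n → ℕ) → ℕ
maxFin {zero}  f = 0
maxFin {suc n} f = f zero ⊔ maxFin (λ i → f (suc i))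

module _ (ℝ : RealNumbers) where
  open RealNumbers ℝ

  Point : ℕ → Set
  Point k = Fin k → Carrier

  fromℕ : ℕ → Carrier
  fromℕ zero    = 0#
  fromℕ (suc n) = 1# + fromℕ n

  sumFin : ∀ {k} → (Fin k → Carrier) → Carrier
  sumFin {zero}  f = 0#
  sumFin {suc k} f = f zero + sumFin (λ i → f (suc i))

  dot : ∀ {k} → Point k → Point k → Carrier
  dot x y = sumFin (λ i → x i * y i)

  _-ᵥ_ : ∀ {k} → Point k → Point k → Point k
  (x -ᵥ y) i = x i + - (y i)

  sqDist : ∀ {k} → Point k → Point k → Carrier
  sqDist x y = dot (x -ᵥ y) (x -ᵥ y)

  -- the Euclidean distance between x and y equals the natural number d
  -- (for d ≥ 0 this is equivalent to |x - y|² = d²)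
  DistIs : ∀ {k} → Point k → Point k → ℕ → Set
  DistIs x y d = sqDist x y ≡ fromℕ d * fromℕ d

  InCommonHyperplane : ∀ {k n} → (Fin n → Point k) → Set
  InCommonHyperplane {k} p =
    Σ (Point k) λ a → (¬ (∀ i → a i ≡ 0#)) ×
    Σ Carrier   λ b → ∀ j → dot a (p j) ≡ b

  record IntegralPointSet (k n : ℕ) : Set where
    field
      pt       : Fin n → Point k
      distinct : ∀ i j → i ≢ j → ¬ (∀ c → pt i c ≡ pt j c)
      dist     : Fin n → Fin n → ℕ
      isDist   : ∀ i j → DistIs (pt i) (pt j) (dist i j)
      nondeg   : ¬ InCommonHyperplane pt

  diam : ∀ {k n} → IntegralPointSet k n → ℕ
  diam P = maxFin λ i → maxFin λ j → IntegralPointSet.dist P i j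

  -- d(m, N) ≤ D : some integral point set of N points in E^m has
  -- diameter at most D  (d(m,N) is the minimum of such diameters)
  MinDiam≤ : ℕ → ℕ → ℕ → Set
  MinDiam≤ m N D = Σ (IntegralPointSet m N) λ Q → diam Q ℕ.≤ D

  -- In the plane: all points except `apex` lie on the line ℓ = {f + t v}
  -- (v ≠ 0), and the apex has distance h from ℓ, i.e. f is the foot of
  -- the perpendicular from the apex and |apex - f| = h.
  LineWithApex : ∀ {n} → IntegralPointSet 2 n → Fin n → Carrier → Set
  LineWithApex {n} P apex h =
    Σ (Point 2) λ f → Σ (Point 2) λ v → (¬ (∀ c → v c ≡ 0#)) ×
      (∀ i → i ≢ apex → ∃ λ t → ∀ c → pt i c ≡ f c + t * v c) ×
      (dot (pt apex -ᵥ f) v ≡ 0#) ×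
      (sqDist (pt apex) f ≡ h * h)
    where open IntegralPointSet P

  OnSphere : ∀ {k n} → IntegralPointSet k n → Carrier → Set
  OnSphere {k} P h = Σ (Point k) λ c → ∀ j → sqDist (IntegralPointSet.pt P j) c ≡ h * h

-- Drop the apex of P. In E^m = ℝ × E^(m-1), put P' in the hyperplane {0} × E^(m-1) and the
-- n - 1 collinear points of P on the line ℝ × {c} through the centre c of its sphere, at their
-- signed distances from the foot of the perpendicular from the apex. Each point of P' lies at
-- distance h from the foot (0, c), perpendicularly to the line, so by Pythagoras it sees the line
-- points exactly as the apex did, and distances within either part are unchanged. The n + n' - 1
-- points thus have integral distances, all occurring in P or P', and they span E^m because P'
-- spans its hyperplane and the line carries two distinct points.

module Submission where

open import Defs
open import Level using (0ℓ)
open import Algebra.Bundles using (CommutativeRing)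
open import Data.Fin using (Fin; zero; suc; punchIn; splitAt; join)
open import Data.Fin.Properties using (punchIn-injective; punchInᵢ≢i; splitAt-join; join-splitAt)
open import Function using (_∘_)
open import Data.Sum using (_⊎_; inj₁; inj₂)
open import Data.Product using (∃; _,_; proj₁; proj₂)
open import Data.Empty using (⊥-elim)
open import Relation.Binary.Definitions using (tri<; tri≈; tri>)
open import Relation.Binary.Structures using (IsStrictTotalOrder)
open import Algebra.Solver.Ring.AlmostCommutativeRing
  using (fromCommutativeRing; _-Raw-AlmostCommutative⟶_)
open import Data.Integer as ℤ using (ℤ; -[1+_]; _⊖_; _◃_)
import Data.Integer.Properties as ℤ
import Data.Nat.Properties as ℕ
open import Data.Maybe using (Maybe; just; nothing)
open import Data.Nat as ℕ using (ℕ; zero; suc)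
open import Data.Sign as Sign using (Sign)
import Relation.Binary.PropositionalEquality as ≡
open import Relation.Nullary using (¬_; yes; no)

-- Coefficients are integers rather than elements of R so that normal forms compare by evaluation.
module IntegerCoefficientSolver {c ℓ} (R : CommutativeRing c ℓ) where
  open CommutativeRing R
  open import Algebra.Properties.Ring ring
    using (-0#≈0#; -‿involutive; -‿+-comm; -‿distribˡ-*; -‿distribʳ-*)
  open import Algebra.Properties.Semiring.Mult semiring using (_×_; ×-homo-+; ×1-homo-*)
  open import Relation.Binary.Reasoning.Setoid setoid

  fromℤ : ℤ → Carrier
  fromℤ (ℤ.+ n)  = n × 1#
  fromℤ -[1+ n ] = - (suc n × 1#)

  private
    [1+x]-[1+y]≈x-y : ∀ x y → (1# + x) - (1# + y) ≈ x - y
    [1+x]-[1+y]≈x-y x y = begin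
      (1# + x) + - (1# + y)   ≈⟨ +-congˡ (-‿+-comm 1# y) ⟨
      (1# + x) + (- 1# + - y) ≈⟨ +-assoc 1# x (- 1# + - y) ⟩
      1# + (x + (- 1# + - y)) ≈⟨ +-congˡ (+-assoc x (- 1#) (- y)) ⟨
      1# + ((x + - 1#) + - y) ≈⟨ +-congˡ (+-congʳ (+-comm x (- 1#))) ⟩
      1# + ((- 1# + x) + - y) ≈⟨ +-congˡ (+-assoc (- 1#) x (- y)) ⟩
      1# + (- 1# + (x + - y)) ≈⟨ +-assoc 1# (- 1#) (x + - y) ⟨
      (1# + - 1#) + (x + - y) ≈⟨ +-congʳ (-‿inverseʳ 1#) ⟩
      0# + (x + - y)          ≈⟨ +-identityˡ (x + - y) ⟩
      x - y                   ∎

    ⊖-homo : ∀ m n → fromℤ (m ⊖ n) ≈ m × 1# - n × 1#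
    ⊖-homo m zero = begin
      fromℤ (m ⊖ 0)  ≡⟨ ≡.cong fromℤ (ℤ.⊖-≥ {m} ℕ.z≤n) ⟩
      m × 1#         ≈⟨ +-identityʳ (m × 1#) ⟨
      m × 1# + 0#    ≈⟨ +-congˡ -0#≈0# ⟨
      m × 1# - 0#    ∎
    ⊖-homo zero (suc n) = begin
      fromℤ (0 ⊖ suc n) ≡⟨ ≡.cong fromℤ (ℤ.⊖-< {0} {suc n} (ℕ.s≤s ℕ.z≤n)) ⟩
      - (suc n × 1#)    ≈⟨ +-identityˡ _ ⟨
      0# - suc n × 1#   ∎
    ⊖-homo (suc m) (suc n) = begin
      fromℤ (suc m ⊖ suc n)   ≡⟨ ≡.cong fromℤ (ℤ.[1+m]⊖[1+n]≡m⊖n m n) ⟩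
      fromℤ (m ⊖ n)           ≈⟨ ⊖-homo m n ⟩
      m × 1# - n × 1#         ≈⟨ [1+x]-[1+y]≈x-y (m × 1#) (n × 1#) ⟨
      suc m × 1# - suc n × 1# ∎

    signed : Sign → Carrier → Carrier
    signed Sign.+ x = x
    signed Sign.- x = - x

    signed-cong : ∀ s {x y} → x ≈ y → signed s x ≈ signed s y
    signed-cong Sign.+ x≈y = x≈y
    signed-cong Sign.- x≈y = -‿cong x≈y

    ◃-homo : ∀ s n → fromℤ (s ◃ n) ≈ signed s (n × 1#)
    ◃-homo Sign.+ zero    = refl
    ◃-homo Sign.- zero    = sym -0#≈0#
    ◃-homo Sign.+ (suc n) = refl
    ◃-homo Sign.- (suc n) = refl

    signed-* : ∀ s t x y → signed (s Sign.* t) (x * y) ≈ signed s x * signed t y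
    signed-* Sign.+ Sign.+ x y = refl
    signed-* Sign.+ Sign.- x y = -‿distribʳ-* x y
    signed-* Sign.- Sign.+ x y = -‿distribˡ-* x y
    signed-* Sign.- Sign.- x y = begin
      x * y       ≈⟨ -‿involutive (x * y) ⟨
      - - (x * y) ≈⟨ -‿cong (-‿distribˡ-* x y) ⟩
      - (- x * y) ≈⟨ -‿distribʳ-* (- x) y ⟩
      - x * - y   ∎

    signed-sign-abs : ∀ i → signed (ℤ.sign i) (ℤ.∣ i ∣ × 1#) ≈ fromℤ i
    signed-sign-abs (ℤ.+ n)  = refl
    signed-sign-abs -[1+ n ] = refl

  +-homo : ∀ i j → fromℤ (i ℤ.+ j) ≈ fromℤ i + fromℤ j
  +-homo -[1+ m ] -[1+ n ] = begin
    - (suc (suc (m ℕ.+ n)) × 1#)    ≡⟨ ≡.cong (λ k → - (suc k × 1#)) (ℕ.+-suc m n) ⟨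
    - ((suc m ℕ.+ suc n) × 1#)      ≈⟨ -‿cong (×-homo-+ 1# (suc m) (suc n)) ⟩
    - (suc m × 1# + suc n × 1#)     ≈⟨ -‿+-comm _ _ ⟨
    - (suc m × 1#) + - (suc n × 1#) ∎
  +-homo -[1+ m ] (ℤ.+ n)  = trans (⊖-homo n (suc m)) (+-comm _ _)
  +-homo (ℤ.+ m)  -[1+ n ] = ⊖-homo m (suc n)
  +-homo (ℤ.+ m)  (ℤ.+ n)  = ×-homo-+ 1# m n

  *-homo : ∀ i j → fromℤ (i ℤ.* j) ≈ fromℤ i * fromℤ j
  *-homo i j = begin
    fromℤ (s ◃ ∣i∣ ℕ.* ∣j∣)
      ≈⟨ ◃-homo s (∣i∣ ℕ.* ∣j∣) ⟩
    signed s ((∣i∣ ℕ.* ∣j∣) × 1#)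
      ≈⟨ signed-cong s (×1-homo-* ∣i∣ ∣j∣) ⟩
    signed s (∣i∣ × 1# * ∣j∣ × 1#)
      ≈⟨ signed-* (ℤ.sign i) (ℤ.sign j) _ _ ⟩
    signed (ℤ.sign i) (∣i∣ × 1#) * signed (ℤ.sign j) (∣j∣ × 1#)
      ≈⟨ *-cong (signed-sign-abs i) (signed-sign-abs j) ⟩
    fromℤ i * fromℤ j ∎
    where
    s = ℤ.sign i Sign.* ℤ.sign j
    ∣i∣ = ℤ.∣ i ∣
    ∣j∣ = ℤ.∣ j ∣

  -‿homo : ∀ i → fromℤ (ℤ.- i) ≈ - fromℤ i
  -‿homo -[1+ n ]    = sym (-‿involutive _)
  -‿homo (ℤ.+ zero)  = sym -0#≈0#
  -‿homo (ℤ.+ suc n) = refl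

  fromℤ-homomorphism : ℤ.+-*-rawRing -Raw-AlmostCommutative⟶ fromCommutativeRing R
  fromℤ-homomorphism = record
    { ⟦_⟧    = fromℤ
    ; +-homo = +-homo
    ; *-homo = *-homo
    ; -‿homo = -‿homo
    ; 0-homo = refl
    ; 1-homo = +-identityʳ 1#
    }

  fromℤ-≟ : ∀ i j → Maybe (fromℤ i ≈ fromℤ j)
  fromℤ-≟ i j with i ℤ.≟ j
  ... | yes ≡.refl = just refl
  ... | no _       = nothing

  open import Algebra.Solver.Ring
    ℤ.+-*-rawRing (fromCommutativeRing R) fromℤ-homomorphism fromℤ-≟ public

maxFin-upper : ∀ {n} (f : Fin n → ℕ) i → f i ℕ.≤ maxFin f
maxFin-upper f zero    = ℕ.m≤m⊔n _ _
maxFin-upper f (suc i) = ℕ.≤-trans (maxFin-upper (f ∘ suc) i) (ℕ.m≤n⊔m _ _)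

maxFin-least : ∀ {n B} (f : Fin n → ℕ) → (∀ i → f i ℕ.≤ B) → maxFin f ℕ.≤ B
maxFin-least {zero}  f f≤B = ℕ.z≤n
maxFin-least {suc n} f f≤B = ℕ.⊔-lub (f≤B zero) (maxFin-least (f ∘ suc) (f≤B ∘ suc))

module Euclidean (ℝ : RealNumbers) where
  open RealNumbers ℝ
    using (Carrier; _+_; _*_; -_; 0#; 1#; _<_; 0≢1; inverse; +-mono-<; *-pos;
           isCommutativeRing; isStrictTotalOrder)
  open IsStrictTotalOrder isStrictTotalOrder using (compare; irrefl) renaming (trans to <-trans)
  open ≡ using (_≡_; _≢_; refl; sym; trans; cong; cong₂; subst; subst₂)
  open ≡.≡-Reasoning

  commutativeRing : CommutativeRing 0ℓ 0ℓ
  commutativeRing = record { isCommutativeRing = isCommutativeRing }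

  open CommutativeRing commutativeRing
    using (_-_; +-comm; +-identityˡ; +-identityʳ; *-identityʳ; *-assoc; -‿inverseʳ;
           zeroˡ; zeroʳ; distribˡ)
  open import Algebra.Properties.Ring (CommutativeRing.ring commutativeRing)
    using (-‿injective; -0#≈0#) renaming (x∙y⁻¹≈ε⇒x≈y to x-y≡0⇒x≡y)
  open IntegerCoefficientSolver commutativeRing using (solve; _:=_; _:+_; _:-_; _:*_; :-_; con)

  infix 4 _≤_
  _≤_ : Carrier → Carrier → Set
  x ≤ y = x < y ⊎ x ≡ y

  x<0⇒0<-x : ∀ {x} → x < 0# → 0# < - x
  x<0⇒0<-x {x} x<0 = subst₂ _<_ (-‿inverseʳ x) (+-identityˡ (- x)) (+-mono-< (- x) x<0)

  -x*-x≡x*x : ∀ x → - x * - x ≡ x * x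
  -x*-x≡x*x = solve 1 (λ x → :- x :* :- x := x :* x) refl

  0≤x*x : ∀ x → 0# ≤ x * x
  0≤x*x x with compare 0# x
  ... | tri< 0<x _ _ = inj₁ (*-pos 0<x 0<x)
  ... | tri≈ _ 0≡x _ = inj₂ (trans (sym (zeroˡ 0#)) (cong₂ _*_ 0≡x 0≡x))
  ... | tri> _ _ x<0 = inj₁ (subst (0# <_) (-x*-x≡x*x x) (*-pos (x<0⇒0<-x x<0) (x<0⇒0<-x x<0)))

  x*x≡0⇒x≡0 : ∀ x → x * x ≡ 0# → x ≡ 0#
  x*x≡0⇒x≡0 x x*x≡0 with compare 0# x
  ... | tri< 0<x _ _ = ⊥-elim (irrefl (sym x*x≡0) (*-pos 0<x 0<x))
  ... | tri≈ _ 0≡x _ = sym 0≡x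
  ... | tri> _ _ x<0 = ⊥-elim (irrefl (sym (trans (-x*-x≡x*x x) x*x≡0))
                                       (*-pos (x<0⇒0<-x x<0) (x<0⇒0<-x x<0)))

  pos+nonneg⇒pos : ∀ {x y} → 0# < x → 0# ≤ y → 0# < x + y
  pos+nonneg⇒pos {x} {y} 0<x (inj₁ 0<y) =
    <-trans (subst (0# <_) (sym (+-identityˡ y)) 0<y) (+-mono-< y 0<x)
  pos+nonneg⇒pos {x} {y} 0<x (inj₂ 0≡y) =
    subst (0# <_) (trans (sym (+-identityʳ x)) (cong (x +_) 0≡y)) 0<x

  nonneg+nonneg⇒nonneg : ∀ {x y} → 0# ≤ x → 0# ≤ y → 0# ≤ x + y
  nonneg+nonneg⇒nonneg (inj₁ 0<x) 0≤y = inj₁ (pos+nonneg⇒pos 0<x 0≤y)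
  nonneg+nonneg⇒nonneg {x} {y} (inj₂ 0≡x) 0≤y =
    subst (0# ≤_) (trans (sym (+-identityˡ y)) (cong (_+ y) 0≡x)) 0≤y

  nonneg+nonneg≡0⇒ˡ≡0 : ∀ {x y} → 0# ≤ x → 0# ≤ y → x + y ≡ 0# → x ≡ 0#
  nonneg+nonneg≡0⇒ˡ≡0 (inj₁ 0<x) 0≤y x+y≡0 =
    ⊥-elim (irrefl (sym x+y≡0) (pos+nonneg⇒pos 0<x 0≤y))
  nonneg+nonneg≡0⇒ˡ≡0 (inj₂ 0≡x) 0≤y x+y≡0 = sym 0≡x

  x*y≡0⇒x≡0 : ∀ {x y} → y ≢ 0# → x * y ≡ 0# → x ≡ 0#
  x*y≡0⇒x≡0 {x} {y} y≢0 x*y≡0 with inverse y y≢0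
  ... | y⁻¹ , y*y⁻¹≡1 = begin
    x               ≡⟨ *-identityʳ x ⟨
    x * 1#          ≡⟨ cong (x *_) y*y⁻¹≡1 ⟨
    x * (y * y⁻¹)   ≡⟨ *-assoc x y y⁻¹ ⟨
    x * y * y⁻¹     ≡⟨ cong (_* y⁻¹) x*y≡0 ⟩
    0# * y⁻¹        ≡⟨ zeroˡ y⁻¹ ⟩
    0#              ∎

  sumFin-cong : ∀ {k} {f g : Fin k → Carrier} → (∀ i → f i ≡ g i) →
                sumFin ℝ f ≡ sumFin ℝ g
  sumFin-cong {zero}  f≗g = refl
  sumFin-cong {suc k} f≗g = cong₂ _+_ (f≗g zero) (sumFin-cong (λ i → f≗g (suc i)))

  sumFin-zero : ∀ {k} {f : Fin k → Carrier} → (∀ i → f i ≡ 0#) → sumFin ℝ f ≡ 0#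
  sumFin-zero {zero}  f≗0 = refl
  sumFin-zero {suc k} f≗0 =
    trans (cong₂ _+_ (f≗0 zero) (sumFin-zero (λ i → f≗0 (suc i)))) (+-identityˡ 0#)

  sumFin-+ : ∀ {k} (f g : Fin k → Carrier) →
             sumFin ℝ (λ i → f i + g i) ≡ sumFin ℝ f + sumFin ℝ g
  sumFin-+ {zero}  f g = sym (+-identityˡ 0#)
  sumFin-+ {suc k} f g = begin
    (f zero + g zero) + sumFin ℝ (λ i → f (suc i) + g (suc i))
      ≡⟨ cong ((f zero + g zero) +_) (sumFin-+ (λ i → f (suc i)) (λ i → g (suc i))) ⟩
    (f zero + g zero) + (sumFin ℝ (λ i → f (suc i)) + sumFin ℝ (λ i → g (suc i)))
      ≡⟨ solve 4 (λ a b c d → (a :+ b) :+ (c :+ d) := (a :+ c) :+ (b :+ d)) refl _ _ _ _ ⟩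
    (f zero + sumFin ℝ (λ i → f (suc i))) + (g zero + sumFin ℝ (λ i → g (suc i))) ∎

  sumFin-*ˡ : ∀ {k} c (f : Fin k → Carrier) → sumFin ℝ (λ i → c * f i) ≡ c * sumFin ℝ f
  sumFin-*ˡ {zero}  c f = sym (zeroʳ c)
  sumFin-*ˡ {suc k} c f =
    trans (cong (c * f zero +_) (sumFin-*ˡ c (λ i → f (suc i)))) (sym (distribˡ c _ _))

  dot-self-nonneg : ∀ {k} (x : Point ℝ k) → 0# ≤ dot ℝ x x
  dot-self-nonneg {zero}  x = inj₂ refl
  dot-self-nonneg {suc k} x =
    nonneg+nonneg⇒nonneg (0≤x*x (x zero)) (dot-self-nonneg (λ i → x (suc i)))

  dot-self≡0⇒≡0 : ∀ {k} (x : Point ℝ k) → dot ℝ x x ≡ 0# → ∀ i → x i ≡ 0#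
  dot-self≡0⇒≡0 {suc k} x x·x≡0 zero =
    x*x≡0⇒x≡0 (x zero)
      (nonneg+nonneg≡0⇒ˡ≡0 (0≤x*x (x zero)) (dot-self-nonneg (λ i → x (suc i))) x·x≡0)
  dot-self≡0⇒≡0 {suc k} x x·x≡0 (suc i) = dot-self≡0⇒≡0 (λ i → x (suc i)) tail≡0 i
    where
    tail≡0 : dot ℝ (λ i → x (suc i)) (λ i → x (suc i)) ≡ 0#
    tail≡0 = nonneg+nonneg≡0⇒ˡ≡0 (dot-self-nonneg (λ i → x (suc i))) (0≤x*x (x zero))
               (trans (+-comm _ _) x·x≡0)

  dot-zeroˡ : ∀ {k} {a : Point ℝ k} (x : Point ℝ k) → (∀ i → a i ≡ 0#) → dot ℝ a x ≡ 0#
  dot-zeroˡ x a≗0 = sumFin-zero (λ i → trans (cong (_* x i) (a≗0 i)) (zeroˡ (x i)))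

  sqDist-self : ∀ {k} (x : Point ℝ k) → sqDist ℝ x x ≡ 0#
  sqDist-self x = sumFin-zero (λ i → trans (cong (λ d → d * d) (-‿inverseʳ (x i))) (zeroˡ 0#))

  sqDist-sym : ∀ {k} (x y : Point ℝ k) → sqDist ℝ x y ≡ sqDist ℝ y x
  sqDist-sym x y = sumFin-cong (λ i →
    solve 2 (λ a b → (a :- b) :* (a :- b) := (b :- a) :* (b :- a)) refl (x i) (y i))

  sqDist-cong : ∀ {k} {x x′ y y′ : Point ℝ k} →
                (∀ i → x i ≡ x′ i) → (∀ i → y i ≡ y′ i) → sqDist ℝ x y ≡ sqDist ℝ x′ y′
  sqDist-cong x≗x′ y≗y′ =
    sumFin-cong (λ i → cong₂ (λ a b → (a - b) * (a - b)) (x≗x′ i) (y≗y′ i))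

  sqDist≡0⇒≗ : ∀ {k} (x y : Point ℝ k) → sqDist ℝ x y ≡ 0# → ∀ i → x i ≡ y i
  sqDist≡0⇒≗ x y d≡0 i = x-y≡0⇒x≡y (x i) (y i) (dot-self≡0⇒≡0 (_-ᵥ_ ℝ x y) d≡0 i)

  dist≤diam : ∀ {k n} (Q : IntegralPointSet ℝ k n) i j →
              IntegralPointSet.dist Q i j ℕ.≤ diam ℝ Q
  dist≤diam Q i j =
    ℕ.≤-trans (maxFin-upper _ j) (maxFin-upper (λ i → maxFin (IntegralPointSet.dist Q i)) i)

  diam≤ : ∀ {k n B} (Q : IntegralPointSet ℝ k n) →
          (∀ i j → IntegralPointSet.dist Q i j ℕ.≤ B) → diam ℝ Q ℕ.≤ B
  diam≤ Q dist≤B = maxFin-least _ (λ i → maxFin-least _ (dist≤B i))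

  private
    e₀ : Point ℝ 2
    e₀ zero    = 1#
    e₀ (suc _) = 0#

    e₀≢0 : ¬ (∀ i → e₀ i ≡ 0#)
    e₀≢0 e₀≡0 = 0≢1 (sym (e₀≡0 zero))

  planar⇒3≤n : ∀ {n} → IntegralPointSet ℝ 2 n → 3 ℕ.≤ n
  planar⇒3≤n {0} P = ⊥-elim (IntegralPointSet.nondeg P (e₀ , e₀≢0 , 0# , λ ()))
  planar⇒3≤n {1} P = ⊥-elim (IntegralPointSet.nondeg P
    (e₀ , e₀≢0 , dot ℝ e₀ (IntegralPointSet.pt P zero) , λ { zero → refl }))
  planar⇒3≤n {2} P = ⊥-elim (nondeg
    (normal , normal≢0 , dot ℝ normal p₀ , λ { zero → refl ; (suc zero) → p₁-on-line }))
    where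
    open IntegralPointSet P
    p₀ p₁ : Point ℝ 2
    p₀ = pt zero
    p₁ = pt (suc zero)
    normal : Point ℝ 2
    normal zero       = - (p₁ (suc zero) - p₀ (suc zero))
    normal (suc zero) = p₁ zero - p₀ zero
    normal≢0 : ¬ (∀ i → normal i ≡ 0#)
    normal≢0 normal≡0 = distinct (suc zero) zero (λ ()) λ
      { zero       → x-y≡0⇒x≡y _ _ (normal≡0 (suc zero))
      ; (suc zero) → x-y≡0⇒x≡y _ _ (-‿injective (trans (normal≡0 zero) (sym -0#≈0#))) }
    p₁-on-line : dot ℝ normal p₁ ≡ dot ℝ normal p₀
    p₁-on-line = solve 4 (λ x₀ y₀ x₁ y₁ →
      :- (y₁ :- y₀) :* x₁ :+ ((x₁ :- x₀) :* y₁ :+ con (ℤ.+ 0)) :=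
      :- (y₁ :- y₀) :* x₀ :+ ((x₁ :- x₀) :* y₀ :+ con (ℤ.+ 0)))
      refl (p₀ zero) (p₀ (suc zero)) (p₁ zero) (p₁ (suc zero))
  planar⇒3≤n {suc (suc (suc n))} P = ℕ.s≤s (ℕ.s≤s (ℕ.s≤s ℕ.z≤n))

  sqDist-on-line : ∀ {k} {f v x y : Point ℝ k} {a b} →
                   (∀ i → x i ≡ f i + a * v i) → (∀ i → y i ≡ f i + b * v i) →
                   sqDist ℝ x y ≡ (a - b) * (a - b) * dot ℝ v v
  sqDist-on-line {f = f} {v} {x} {y} {a} {b} x-on-line y-on-line = begin
    sqDist ℝ x y                                     ≡⟨ sumFin-cong coordinate ⟩
    sumFin ℝ (λ i → (a - b) * (a - b) * (v i * v i)) ≡⟨ sumFin-*ˡ _ (λ i → v i * v i) ⟩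
    (a - b) * (a - b) * dot ℝ v v                    ∎
    where
    coordinate : ∀ i → (x i - y i) * (x i - y i) ≡ (a - b) * (a - b) * (v i * v i)
    coordinate i = trans (cong₂ (λ p q → (p - q) * (p - q)) (x-on-line i) (y-on-line i))
      (solve 4 (λ f v a b → (f :+ a :* v :- (f :+ b :* v)) :* (f :+ a :* v :- (f :+ b :* v))
                          := (a :- b) :* (a :- b) :* (v :* v)) refl (f i) (v i) a b)

  sqDist-from-line : ∀ {k} {f v x A : Point ℝ k} {a} →
                     (∀ i → x i ≡ f i + a * v i) → dot ℝ (_-ᵥ_ ℝ A f) v ≡ 0# →
                     sqDist ℝ x A ≡ a * a * dot ℝ v v + sqDist ℝ A f
  sqDist-from-line {f = f} {v} {x} {A} {a} x-on-line perpendicular = begin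
    sqDist ℝ x A
      ≡⟨ sumFin-cong coordinate ⟩
    sumFin ℝ (λ i → along i + (across i + height i))
      ≡⟨ sumFin-+ along (λ i → across i + height i) ⟩
    sumFin ℝ along + sumFin ℝ (λ i → across i + height i)
      ≡⟨ cong (sumFin ℝ along +_) (sumFin-+ across height) ⟩
    sumFin ℝ along + (sumFin ℝ across + sqDist ℝ A f)
      ≡⟨ cong₂ (λ p q → p + (q + sqDist ℝ A f)) (sumFin-*ˡ (a * a) (λ i → v i * v i))
                                               (sumFin-*ˡ (- (a + a)) (λ i → (A i - f i) * v i)) ⟩
    a * a * dot ℝ v v + (- (a + a) * dot ℝ (_-ᵥ_ ℝ A f) v + sqDist ℝ A f)
      ≡⟨ cong (λ p → a * a * dot ℝ v v + (- (a + a) * p + sqDist ℝ A f)) perpendicular ⟩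
    a * a * dot ℝ v v + (- (a + a) * 0# + sqDist ℝ A f)
      ≡⟨ cong (a * a * dot ℝ v v +_) (trans (cong (_+ sqDist ℝ A f) (zeroʳ (- (a + a))))
                                            (+-identityˡ (sqDist ℝ A f))) ⟩
    a * a * dot ℝ v v + sqDist ℝ A f ∎
    where
    along across height : Fin _ → Carrier
    along  i = a * a * (v i * v i)
    across i = - (a + a) * ((A i - f i) * v i)
    height i = (A i - f i) * (A i - f i)

    coordinate : ∀ i → (x i - A i) * (x i - A i) ≡ along i + (across i + height i)
    coordinate i = trans (cong (λ p → (p - A i) * (p - A i)) (x-on-line i))
      (solve 4 (λ f v A a → (f :+ a :* v :- A) :* (f :+ a :* v :- A)
                          := a :* a :* (v :* v)
                             :+ (:- (a :+ a) :* ((A :- f) :* v) :+ (A :- f) :* (A :- f)))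
               refl (f i) (v i) (A i) a)

  -- Without square roots, the length of v is read off one known distance d as d / (a - b).
  line-scale : ∀ {k} {f v x y : Point ℝ k} {a b} d →
               (∀ i → x i ≡ f i + a * v i) → (∀ i → y i ≡ f i + b * v i) →
               a ≢ b → sqDist ℝ x y ≡ d * d → ∃ λ ℓ → ℓ * ℓ ≡ dot ℝ v v
  line-scale {v = v} {a = a} {b} d x-on-line y-on-line a≢b sqDist≡d*d
    with inverse (a - b) (λ a-b≡0 → a≢b (x-y≡0⇒x≡y a b a-b≡0))
  ... | ι , [a-b]ι≡1 = d * ι , (begin
    d * ι * (d * ι)
      ≡⟨ solve 2 (λ d ι → d :* ι :* (d :* ι) := d :* d :* (ι :* ι)) refl d ι ⟩
    d * d * (ι * ι)
      ≡⟨ cong (_* (ι * ι)) (trans (sym sqDist≡d*d) (sqDist-on-line x-on-line y-on-line)) ⟩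
    (a - b) * (a - b) * V * (ι * ι)
      ≡⟨ solve 4 (λ a b V ι → (a :- b) :* (a :- b) :* V :* (ι :* ι)
                            := V :* (((a :- b) :* ι) :* ((a :- b) :* ι))) refl a b V ι ⟩
    V * (((a - b) * ι) * ((a - b) * ι)) ≡⟨ cong (λ p → V * (p * p)) [a-b]ι≡1 ⟩
    V * (1# * 1#)                       ≡⟨ cong (V *_) (*-identityʳ 1#) ⟩
    V * 1#                              ≡⟨ *-identityʳ V ⟩
    V                                   ∎)
    where
    V : Carrier
    V = dot ℝ v v

  -- Points coord k on an axis, at integral distances from each other and from the apex at
  -- height h above the origin of the axis.
  record Fan (h : Carrier) (n : ℕ) : Set where
    field
      coord          : Fin n → Carrier
      coord-distinct : ∀ k l → k ≢ l → coord k ≢ coord l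
      dist           : Fin n → Fin n → ℕ
      isDist         : ∀ k l → (coord k - coord l) * (coord k - coord l) ≡
                               fromℕ ℝ (dist k l) * fromℕ ℝ (dist k l)
      apexDist       : Fin n → ℕ
      isApexDist     : ∀ k → coord k * coord k + h * h ≡
                             fromℕ ℝ (apexDist k) * fromℕ ℝ (apexDist k)

  lineFan : ∀ {n h} (P : IntegralPointSet ℝ 2 (suc n)) (apex : Fin (suc n)) →
            LineWithApex ℝ P apex h → (i₁ i₂ : Fin n) → i₁ ≢ i₂ → Fan h n
  lineFan {n} {h} P apex (f , v , _ , on-line , perpendicular , foot-height) i₁ i₂ i₁≢i₂ = record
    { coord          = coord
    ; coord-distinct = coord-distinct
    ; dist           = λ k l → dist (base k) (base l)
    ; isDist         = λ k l → trans (coord-sqDist k l) (isDist (base k) (base l))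
    ; apexDist       = λ k → dist (base k) apex
    ; isApexDist     = λ k → trans (coord-sqDist-apex k) (isDist (base k) apex)
    }
    where
    open IntegralPointSet P

    base : Fin n → Fin (suc n)
    base = punchIn apex

    base-injective : ∀ {k l} → k ≢ l → base k ≢ base l
    base-injective {k} {l} k≢l = k≢l ∘ punchIn-injective apex k l

    t : Fin n → Carrier
    t k = proj₁ (on-line (base k) (punchInᵢ≢i apex k))

    base-on-line : ∀ k i → pt (base k) i ≡ f i + t k * v i
    base-on-line k = proj₂ (on-line (base k) (punchInᵢ≢i apex k))

    t₁≢t₂ : t i₁ ≢ t i₂
    t₁≢t₂ t₁≡t₂ = distinct (base i₁) (base i₂) (base-injective i₁≢i₂) λ i → begin
      pt (base i₁) i    ≡⟨ base-on-line i₁ i ⟩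
      f i + t i₁ * v i  ≡⟨ cong (λ s → f i + s * v i) t₁≡t₂ ⟩
      f i + t i₂ * v i  ≡⟨ base-on-line i₂ i ⟨
      pt (base i₂) i    ∎

    scale : ∃ λ ℓ → ℓ * ℓ ≡ dot ℝ v v
    scale = line-scale (fromℕ ℝ (dist (base i₁) (base i₂)))
              (base-on-line i₁) (base-on-line i₂) t₁≢t₂ (isDist (base i₁) (base i₂))

    ℓ : Carrier
    ℓ = proj₁ scale

    coord : Fin n → Carrier
    coord k = t k * ℓ

    coord-sqDist : ∀ k l → (coord k - coord l) * (coord k - coord l) ≡
                           sqDist ℝ (pt (base k)) (pt (base l))
    coord-sqDist k l = begin
      (t k * ℓ - t l * ℓ) * (t k * ℓ - t l * ℓ)
        ≡⟨ solve 3 (λ a b ℓ → (a :* ℓ :- b :* ℓ) :* (a :* ℓ :- b :* ℓ)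
                            := (a :- b) :* (a :- b) :* (ℓ :* ℓ)) refl (t k) (t l) ℓ ⟩
      (t k - t l) * (t k - t l) * (ℓ * ℓ)
        ≡⟨ cong ((t k - t l) * (t k - t l) *_) (proj₂ scale) ⟩
      (t k - t l) * (t k - t l) * dot ℝ v v
        ≡⟨ sqDist-on-line (base-on-line k) (base-on-line l) ⟨
      sqDist ℝ (pt (base k)) (pt (base l)) ∎

    coord-sqDist-apex : ∀ k → coord k * coord k + h * h ≡ sqDist ℝ (pt (base k)) (pt apex)
    coord-sqDist-apex k = begin
      t k * ℓ * (t k * ℓ) + h * h
        ≡⟨ cong (_+ h * h)
             (solve 2 (λ t ℓ → t :* ℓ :* (t :* ℓ) := t :* t :* (ℓ :* ℓ)) refl (t k) ℓ) ⟩
      t k * t k * (ℓ * ℓ) + h * h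
        ≡⟨ cong₂ (λ p q → t k * t k * p + q) (proj₂ scale) (sym foot-height) ⟩
      t k * t k * dot ℝ v v + sqDist ℝ (pt apex) f
        ≡⟨ sqDist-from-line {A = pt apex} (base-on-line k) perpendicular ⟨
      sqDist ℝ (pt (base k)) (pt apex) ∎

    coord-distinct : ∀ k l → k ≢ l → coord k ≢ coord l
    coord-distinct k l k≢l coord-k≡coord-l = distinct (base k) (base l) (base-injective k≢l)
      (sqDist≡0⇒≗ (pt (base k)) (pt (base l)) (trans (sym (coord-sqDist k l)) (begin
        (coord k - coord l) * (coord k - coord l)
          ≡⟨ cong (λ p → (p - coord l) * (p - coord l)) coord-k≡coord-l ⟩
        (coord l - coord l) * (coord l - coord l)
          ≡⟨ cong (λ p → p * p) (-‿inverseʳ (coord l)) ⟩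
        0# * 0#
          ≡⟨ zeroˡ 0# ⟩
        0# ∎)))

  module Cone {n n′ m h} (0<h : 0# < h) (F : Fan h n) (i₁ i₂ : Fin n) (i₁≢i₂ : i₁ ≢ i₂)
              (Q : IntegralPointSet ℝ m n′) (sphere : OnSphere ℝ Q h) where
    open Fan F
    module Q = IntegralPointSet Q

    centre : Point ℝ m
    centre = proj₁ sphere

    point : Fin n ⊎ Fin n′ → Point ℝ (suc m)
    point (inj₁ k) zero    = coord k
    point (inj₁ k) (suc i) = centre i
    point (inj₂ j) zero    = 0#
    point (inj₂ j) (suc i) = Q.pt j i

    distance : Fin n ⊎ Fin n′ → Fin n ⊎ Fin n′ → ℕ
    distance (inj₁ k) (inj₁ l)  = dist k l
    distance (inj₁ k) (inj₂ _)  = apexDist k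
    distance (inj₂ _) (inj₁ k)  = apexDist k
    distance (inj₂ j) (inj₂ j′) = Q.dist j j′

    fan-to-sphere : ∀ k j → sqDist ℝ (point (inj₁ k)) (point (inj₂ j)) ≡
                            coord k * coord k + h * h
    fan-to-sphere k j = cong₂ _+_
      (solve 1 (λ s → (s :- con (ℤ.+ 0)) :* (s :- con (ℤ.+ 0)) := s :* s) refl (coord k))
      (trans (sqDist-sym centre (Q.pt j)) (proj₂ sphere j))

    isDistance : ∀ x y → DistIs ℝ (point x) (point y) (distance x y)
    isDistance (inj₁ k) (inj₁ l) = begin
      (coord k - coord l) * (coord k - coord l) + sqDist ℝ centre centre
        ≡⟨ cong ((coord k - coord l) * (coord k - coord l) +_) (sqDist-self centre) ⟩
      (coord k - coord l) * (coord k - coord l) + 0#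
        ≡⟨ +-identityʳ _ ⟩
      (coord k - coord l) * (coord k - coord l)
        ≡⟨ isDist k l ⟩
      fromℕ ℝ (dist k l) * fromℕ ℝ (dist k l) ∎
    isDistance (inj₁ k) (inj₂ j)  = trans (fan-to-sphere k j) (isApexDist k)
    isDistance (inj₂ j) (inj₁ k)  =
      trans (sqDist-sym (point (inj₂ j)) (point (inj₁ k))) (isDistance (inj₁ k) (inj₂ j))
    isDistance (inj₂ j) (inj₂ j′) = trans
      (solve 1 (λ d → (con (ℤ.+ 0) :- con (ℤ.+ 0)) :* (con (ℤ.+ 0) :- con (ℤ.+ 0)) :+ d := d)
        refl (sqDist ℝ (Q.pt j) (Q.pt j′)))
      (Q.isDist j j′)

    centre-off-sphere : ∀ j → ¬ (∀ i → Q.pt j i ≡ centre i)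
    centre-off-sphere j q≗centre = irrefl 0≡h*h (*-pos 0<h 0<h)
      where
      0≡h*h : 0# ≡ h * h
      0≡h*h = begin
        0#                         ≡⟨ sqDist-self centre ⟨
        sqDist ℝ centre centre     ≡⟨ sqDist-cong (sym ∘ q≗centre) (λ _ → refl) ⟩
        sqDist ℝ (Q.pt j) centre   ≡⟨ proj₂ sphere j ⟩
        h * h                      ∎

    point-distinct : ∀ x y → x ≢ y → ¬ (∀ i → point x i ≡ point y i)
    point-distinct (inj₁ k) (inj₁ l)  x≢y x≗y = coord-distinct k l (x≢y ∘ cong inj₁) (x≗y zero)
    point-distinct (inj₁ k) (inj₂ j)  _   x≗y = centre-off-sphere j (sym ∘ x≗y ∘ suc)
    point-distinct (inj₂ j) (inj₁ k)  _   x≗y = centre-off-sphere j (x≗y ∘ suc)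
    point-distinct (inj₂ j) (inj₂ j′) x≢y x≗y = Q.distinct j j′ (x≢y ∘ cong inj₂) (x≗y ∘ suc)

    -- Q spans the last m coordinates, so a hyperplane through all points would be
    -- orthogonal to the axis, which carries two distinct points.
    no-hyperplane : ¬ InCommonHyperplane ℝ (point ∘ splitAt n)
    no-hyperplane (a , a≢0 , b , on-plane) = Q.nondeg (a ∘ suc , tail≢0 , b , sphere-on-plane)
      where
      point-on-plane : ∀ x → dot ℝ a (point x) ≡ b
      point-on-plane x =
        subst (λ y → dot ℝ a (point y) ≡ b) (splitAt-join n n′ x) (on-plane (join n n′ x))

      sphere-on-plane : ∀ j → dot ℝ (a ∘ suc) (Q.pt j) ≡ b
      sphere-on-plane j = begin
        dot ℝ (a ∘ suc) (Q.pt j)               ≡⟨ +-identityˡ _ ⟨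
        0# + dot ℝ (a ∘ suc) (Q.pt j)          ≡⟨ cong (_+ dot ℝ (a ∘ suc) (Q.pt j)) (zeroʳ (a zero)) ⟨
        a zero * 0# + dot ℝ (a ∘ suc) (Q.pt j) ≡⟨ point-on-plane (inj₂ j) ⟩
        b                                      ∎

      tail≢0 : ¬ (∀ i → a (suc i) ≡ 0#)
      tail≢0 tail≡0 = a≢0 λ { zero → a₀≡0 ; (suc i) → tail≡0 i }
        where
        axis-on-plane : ∀ k → a zero * coord k ≡ b
        axis-on-plane k = begin
          a zero * coord k                          ≡⟨ +-identityʳ _ ⟨
          a zero * coord k + 0#                     ≡⟨ cong (_ +_) (dot-zeroˡ centre tail≡0) ⟨
          a zero * coord k + dot ℝ (a ∘ suc) centre ≡⟨ point-on-plane (inj₁ k) ⟩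
          b                                         ∎

        a₀≡0 : a zero ≡ 0#
        a₀≡0 = x*y≡0⇒x≡0 (coord-distinct i₁ i₂ i₁≢i₂ ∘ x-y≡0⇒x≡y _ _) (begin
          a zero * (coord i₁ - coord i₂)
            ≡⟨ solve 3 (λ a x y → a :* (x :- y) := a :* x :- a :* y) refl (a zero) (coord i₁) (coord i₂) ⟩
          a zero * coord i₁ - a zero * coord i₂
            ≡⟨ cong₂ _-_ (axis-on-plane i₁) (axis-on-plane i₂) ⟩
          b - b
            ≡⟨ -‿inverseʳ b ⟩
          0# ∎)

    coneSet : IntegralPointSet ℝ (suc m) (n ℕ.+ n′)
    coneSet = record
      { pt       = point ∘ splitAt n
      ; distinct = λ i j i≢j →
          point-distinct (splitAt n i) (splitAt n j) (i≢j ∘ splitAt-injective i j)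
      ; dist     = λ i j → distance (splitAt n i) (splitAt n j)
      ; isDist   = λ i j → isDistance (splitAt n i) (splitAt n j)
      ; nondeg   = no-hyperplane
      }
      where
      splitAt-injective : ∀ i j → splitAt n i ≡ splitAt n j → i ≡ j
      splitAt-injective i j eq = begin
        i                       ≡⟨ join-splitAt n n′ i ⟨
        join n n′ (splitAt n i) ≡⟨ cong (join n n′) eq ⟩
        join n n′ (splitAt n j) ≡⟨ join-splitAt n n′ j ⟩
        j                       ∎

    diam-coneSet≤ : ∀ {B} → (∀ k l → dist k l ℕ.≤ B) → (∀ k → apexDist k ℕ.≤ B) →
                    diam ℝ Q ℕ.≤ B → diam ℝ coneSet ℕ.≤ B
    diam-coneSet≤ {B} dist≤B apexDist≤B diamQ≤B =
      diam≤ coneSet (λ i j → distance≤B (splitAt n i) (splitAt n j))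
      where
      distance≤B : ∀ x y → distance x y ℕ.≤ B
      distance≤B (inj₁ k) (inj₁ l)  = dist≤B k l
      distance≤B (inj₁ k) (inj₂ _)  = apexDist≤B k
      distance≤B (inj₂ _) (inj₁ k)  = apexDist≤B k
      distance≤B (inj₂ j) (inj₂ j′) = ℕ.≤-trans (dist≤diam Q j j′) diamQ≤B

open import Data.Nat using (_+_; _∸_; _≤_; _⊔_)

theorem4 : (ℝ : RealNumbers) →
    (m : ℕ) → 2 ≤ m →
    (n : ℕ) (P : IntegralPointSet ℝ 2 n) (apex : Fin n)
    (h : RealNumbers.Carrier ℝ) → RealNumbers._<_ ℝ (RealNumbers.0# ℝ) h →
    LineWithApex ℝ P apex h →
    (n' : ℕ) (P' : IntegralPointSet ℝ (m ∸ 1) n') → OnSphere ℝ P' h →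
    MinDiam≤ ℝ m (n + n' ∸ 1) (diam ℝ P ⊔ diam ℝ P')
theorem4 ℝ zero () n P apex h 0<h line n' P' sphere
theorem4 ℝ (suc m) _ (suc n) P apex h 0<h line n' P' sphere with Euclidean.planar⇒3≤n ℝ P
... | ℕ.s≤s (ℕ.s≤s (ℕ.s≤s _)) =
  coneSet , diam-coneSet≤ (λ k l → within-diam-P (dist≤diam P _ _))
                          (λ k → within-diam-P (dist≤diam P _ _))
                          (ℕ.m≤n⊔m (diam ℝ P) (diam ℝ P'))
  where
  open Euclidean ℝ using (dist≤diam; lineFan; module Cone)
  open Cone 0<h (lineFan P apex line zero (suc zero) (λ ())) zero (suc zero) (λ ()) P' sphere

  within-diam-P : ∀ {d} → d ≤ diam ℝ P → d ≤ diam ℝ P ⊔ diam ℝ P'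
  within-diam-P d≤diam = ℕ.≤-trans d≤diam (ℕ.m≤m⊔n (diam ℝ P) (diam ℝ P'))
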